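{- Let $\Omega_1=\{0,1\}^{\mathbb N\times\mathbb N}$ with evaluation set $\Lambda_{\mathrm{mat}}=\{A\mapsto A(i,j):(i,j)\in\mathbb N^2\}$ and let $\Xi_m:\Omega_1\to\{0,1\}$ be as defined below. For every $m\ge1$, $\Xi_m\in\Delta^G_m$, i.e. $\Xi_m$ is computed by a tower of general algorithms of height $m$.
   Context: For each $m\ge1$ fix a bijection $\beta_m:\mathbb N^m\to\mathbb N\times\mathbb N$, $\beta_m(n_1,\dots,n_m)=(i(n_1,\dots,n_m),j(n_1,\dots,n_m))$, and put $P_m(A;n_1,\dots,n_m)=a_{i(n_1,\dots,n_m),j(n_1,\dots,n_m)}$ for $A=(a_{i,j})$. With alternating quantifiers $Q_1=\exists,Q_2=\forall,\dots$, $\Xi_m(A)=1$ iff $(Q_1n_1)\cdots(Q_mn_m)[P_m(A;n_1,\dots,n_m)=1]$. $\{0,1\}$ has the discrete metric. A general algorithm is a map $\Gamma:\Omega_1\to\{0,1\}$ such that for each $A$ there is a finite nonempty $\Lambda_\Gamma(A)\subset\Lambda_{\mathrm{mat}}$ with $\Gamma(A)$ depending only on $\{f(A):f\in\Lambda_\Gamma(A)\}$, and with $\Lambda_\Gamma(B)=\Lambda_\Gamma(A)$ whenever $f(B)=f(A)$ for all $f\in\Lambda_\Gamma(A)$. A tower of height $k$ is a family of general algorithms $\Gamma_{n_k,\dots,n_1}$ whose iterated pointwise limits exist at each stage and equal $\Xi$; $\Delta^G_k$ is the class of problems with such a tower of height $\le k$. -}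

module Defs where

open import Data.Nat using (ℕ; zero; suc; _≤_)
open import Data.Bool using (Bool; true; false)
open import Data.Product using (Σ; Σ-syntax; _×_; _,_)
open import Data.List using (List; [])
open import Data.List.Membership.Propositional using (_∈_)
open import Data.Vec using (Vec; []; _∷_)
open import Relation.Binary.PropositionalEquality using (_≡_; _≢_)
open import Relation.Nullary using (¬_)
open import Function.Bundles using (_⤖_; Bijection; _⇔_)

-- The domain Ω₁ = {0,1}^(ℕ×ℕ): infinite 0/1 matrices (Bool, false = 0, true = 1).
Ω₁ : Set
Ω₁ = ℕ → ℕ → Bool

Pos : Set
Pos = ℕ × ℕ

eval : Pos → Ω₁ → Bool
eval (i , j) A = A i j

-- A general algorithm Γ : Ω₁ → {0,1} with a finite, nonempty, consistent
-- set of evaluations Λ_Γ(A) ⊂ Λ_mat (represented as a list of positions).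
record GeneralAlgorithm : Set where
  field
    Γ         : Ω₁ → Bool
    Λ         : Ω₁ → List Pos
    nonempty  : ∀ A → Λ A ≢ []
    dependsOn : ∀ A B → (∀ p → p ∈ Λ A → eval p B ≡ eval p A) → Γ B ≡ Γ A
    consistent : ∀ A B → (∀ p → p ∈ Λ A → eval p B ≡ eval p A) →
                 ∀ p → (p ∈ Λ B) ⇔ (p ∈ Λ A)

-- Limit in the discrete metric on {0,1}: the sequence is eventually constant b.
Limit : (ℕ → Bool) → Bool → Set
Limit s b = Σ[ N ∈ ℕ ] (∀ n → N ≤ n → s n ≡ b)

-- Iterated pointwise limits of a family g_{n_k,…,n_1}, indexed by the vector
-- (n_1 , … , n_k), exist at each stage and the final one is a value of the
-- (possibly non-computable) problem Ξ, given as a relation R A b ("Ξ(A) = b").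
-- The innermost limit is taken over n_1 (the head of the vector).
IteratedLimits : (k : ℕ) → (Vec ℕ k → Ω₁ → Bool) → (Ω₁ → Bool → Set) → Set
IteratedLimits zero    g R = ∀ A → R A (g [] A)
IteratedLimits (suc k) g R =
  Σ[ g′ ∈ (Vec ℕ k → Ω₁ → Bool) ]
    ((∀ ns A → Limit (λ n → g (n ∷ ns) A) (g′ ns A)) × IteratedLimits k g′ R)

Tower : (k : ℕ) → (Ω₁ → Bool → Set) → Set
Tower k R =
  Σ[ Γs ∈ (Vec ℕ k → GeneralAlgorithm) ]
    IteratedLimits k (λ ns → GeneralAlgorithm.Γ (Γs ns)) R

-- Alternating quantifier prefix (Q₁ n₁)…(Q_k n_k) P(n₁,…,n_k);
-- the Bool says whether the first quantifier is ∃ (true) or ∀ (false).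
Alt : (k : ℕ) → Bool → (Vec ℕ k → Set) → Set
Alt zero    _     P = P []
Alt (suc k) true  P = Σ[ n ∈ ℕ ] Alt k false (λ ns → P (n ∷ ns))
Alt (suc k) false P = ∀ n → Alt k true (λ ns → P (n ∷ ns))

Pm : (m : ℕ) → (Vec ℕ m ⤖ (ℕ × ℕ)) → Ω₁ → Vec ℕ m → Bool
Pm m β A ns = eval (Bijection.to β ns) A

Xi : (m : ℕ) → (Vec ℕ m ⤖ (ℕ × ℕ)) → Ω₁ → Bool → Set
Xi m β A b = (b ≡ true) ⇔ Alt m true (λ ns → Pm m β A ns ≡ true)

-- Bound the first k quantifiers of (Q₁ n₁)⋯(Q_m n_m) P to ranges nᵢ ≤ bᵢ and
-- decide the remaining m ∸ k exactly (by excluded middle).  With all m quantifiers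
-- bounded this reads only the entries a_{β(n)} with n in the finite box ∏ [0, bᵢ],
-- so it is a general algorithm.  Letting the innermost bound go to infinity turns a
-- bounded quantifier into the unbounded one: a bounded ∃ (∀) becomes constant once
-- its range contains a witness (counterexample), and is constant anyway if there is
-- none.  Releasing the bounds from the last quantifier back to the first gives the
-- m successive limits.
module Submission where

open import Defs
open import Level using (0ℓ)
open import Data.Nat using (ℕ; _≤_)
open import Data.Product using (_×_)
open import Data.Vec using (Vec)
open import Function.Bundles using (_⤖_)
open import Axiom.ExcludedMiddle using (ExcludedMiddle)

open import Data.Bool using (Bool; true; false; not; _∨_; _∧_)
open import Data.Bool.Properties using (∨-zeroʳ; ∧-zeroʳ; ∨-idem; ∧-idem; not-¬; ¬-not)
open import Data.Nat using (zero; suc; _<_; _⊔_; z≤n; s≤s)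
open import Data.Nat.Properties
  using (≤-refl; ≤-trans; <⇒≤; m≤m⊔n; m≤n⊔m; m≤n⇒m≤1+n; m≤n⇒m<n∨m≡n)
open import Data.Product using (Σ-syntax; _,_)
open import Data.Sum using (inj₁; inj₂)
open import Data.List using (List; []; _∷_; [_]; map; upTo; cartesianProductWith)
open import Data.List.Membership.Propositional using (_∈_)
open import Data.List.Membership.Propositional.Properties
  using (∈-map⁺; ∈-upTo⁺; ∈-cartesianProductWith⁺)
open import Data.List.Relation.Unary.Any using (here)
open import Data.Vec using ([]; _∷_; _∷ʳ_; reverse; replicate)
open import Data.Vec.Properties using (reverse-∷)
open import Function.Bundles using (Bijection; _⇔_; mk⇔; Equivalence)
open import Function.Construct.Identity using (⇔-id)
open import Relation.Nullary using (Dec; yes; no)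
open import Relation.Nullary.Decidable using (dec-true; dec-false; does-⇔)
open import Relation.Binary.PropositionalEquality using (_≡_; _≢_; refl; sym; trans; cong; cong₂; subst)

limit-map₂ : (f : Bool → Bool → Bool) {s t : ℕ → Bool} {a c : Bool} →
  Limit s a → Limit t c → Limit (λ n → f (s n) (t n)) (f a c)
limit-map₂ f (N₁ , s→a) (N₂ , t→c) = N₁ ⊔ N₂ , λ n N≤n →
  cong₂ f (s→a n (≤-trans (m≤m⊔n N₁ N₂) N≤n)) (t→c n (≤-trans (m≤n⊔m N₁ N₂) N≤n))

limit-congˡ : {s t : ℕ → Bool} {a : Bool} → (∀ n → s n ≡ t n) → Limit t a → Limit s a
limit-congˡ s≗t (N , t→a) = N , λ n N≤n → trans (s≗t n) (t→a n N≤n)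

connective : Bool → Bool → Bool → Bool
connective true  = _∨_
connective false = _∧_

connective-zeroˡ : ∀ b y → connective b b y ≡ b
connective-zeroˡ true  _ = refl
connective-zeroˡ false _ = refl

connective-zeroʳ : ∀ b y → connective b y b ≡ b
connective-zeroʳ true  = ∨-zeroʳ
connective-zeroʳ false = ∧-zeroʳ

connective-idem : ∀ b y → connective b y y ≡ y
connective-idem true  = ∨-idem
connective-idem false = ∧-idem

bounded : Bool → ℕ → (ℕ → Bool) → Bool
bounded b zero    h = h 0
bounded b (suc n) h = connective b (bounded b n h) (h (suc n))

bounded-limit : ∀ b n {f : ℕ → ℕ → Bool} {g : ℕ → Bool} →
  (∀ x → Limit (λ k → f k x) (g x)) → Limit (λ k → bounded b n (f k)) (bounded b n g)
bounded-limit b zero    f→g = f→g 0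
bounded-limit b (suc n) f→g = limit-map₂ (connective b) (bounded-limit b n f→g) (f→g (suc n))

bounded-cong : ∀ b n {h h′ : ℕ → Bool} → (∀ x → x ≤ n → h x ≡ h′ x) →
  bounded b n h ≡ bounded b n h′
bounded-cong b zero    h≗h′ = h≗h′ 0 z≤n
bounded-cong b (suc n) h≗h′ = cong₂ (connective b)
  (bounded-cong b n (λ x x≤n → h≗h′ x (m≤n⇒m≤1+n x≤n))) (h≗h′ (suc n) ≤-refl)

bounded-witness : ∀ b n {h : ℕ → Bool} {x} → x ≤ n → h x ≡ b → bounded b n h ≡ b
bounded-witness b zero    z≤n hx≡b = hx≡b
bounded-witness b (suc n) {h} x≤1+n hx≡b with m≤n⇒m<n∨m≡n x≤1+n
... | inj₁ (s≤s x≤n) = trans (cong (λ y → connective b y (h (suc n))) (bounded-witness b n x≤n hx≡b))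
                             (connective-zeroˡ b (h (suc n)))
... | inj₂ refl      = trans (cong (connective b (bounded b n h)) hx≡b) (connective-zeroʳ b (bounded b n h))

bounded-constant : ∀ b n {h : ℕ → Bool} {c} → (∀ x → h x ≡ c) → bounded b n h ≡ c
bounded-constant b zero    h≡c = h≡c 0
bounded-constant b (suc n) {c = c} h≡c =
  trans (cong₂ (connective b) (bounded-constant b n h≡c) (h≡c (suc n))) (connective-idem b c)

box : ∀ {r} → Vec ℕ r → List (Vec ℕ r)
box []       = [ [] ]
box (n ∷ bs) = cartesianProductWith _∷_ (upTo (suc n)) (box bs)

zeros∈box : ∀ {r} (bs : Vec ℕ r) → replicate r 0 ∈ box bs
zeros∈box []       = here refl
zeros∈box (n ∷ bs) = ∈-cartesianProductWith⁺ _∷_ (∈-upTo⁺ {suc n} (s≤s z≤n)) (zeros∈box bs)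

Quant : Bool → (ℕ → Bool) → Set
Quant true  h = Σ[ x ∈ ℕ ] h x ≡ true
Quant false h = ∀ x → h x ≡ true

Quant⇔Alt : ∀ b r {h : ℕ → Bool} {R : Vec ℕ (suc r) → Set} →
  (∀ x → h x ≡ true ⇔ Alt r (not b) (λ xs → R (x ∷ xs))) → Quant b h ⇔ Alt (suc r) b R
Quant⇔Alt true  r h⇔R = mk⇔
  (λ (x , hx) → x , Equivalence.to (h⇔R x) hx)
  (λ (x , Rx) → x , Equivalence.from (h⇔R x) Rx)
Quant⇔Alt false r h⇔R = mk⇔
  (λ ∀h x → Equivalence.to (h⇔R x) (∀h x))
  (λ ∀R x → Equivalence.from (h⇔R x) (∀R x))

module Classical (lem : ExcludedMiddle 0ℓ) where

  ⟦_⟧ : Set → Bool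
  ⟦ S ⟧ = Dec.does (lem {S})

  ⟦⟧-true⇔ : ∀ {S} → ⟦ S ⟧ ≡ true ⇔ S
  ⟦⟧-true⇔ {S} = mk⇔ sound (dec-true lem)
    where
    sound : ⟦ S ⟧ ≡ true → S
    sound ⟦S⟧≡true with lem {S}
    sound refl | yes s = s

  ⟦⟧-cong : ∀ {S T} → S ⇔ T → ⟦ S ⟧ ≡ ⟦ T ⟧
  ⟦⟧-cong S⇔T = does-⇔ S⇔T lem lem

  ⟦Quant⟧-witness : ∀ b {h : ℕ → Bool} {x} → h x ≡ b → ⟦ Quant b h ⟧ ≡ b
  ⟦Quant⟧-witness true  {x = x} hx≡true  = dec-true lem (x , hx≡true)
  ⟦Quant⟧-witness false {x = x} hx≡false = dec-false lem λ ∀h → not-¬ hx≡false (∀h x)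

  ⟦Quant⟧-constant : ∀ b {h : ℕ → Bool} → (∀ x → h x ≡ not b) → ⟦ Quant b h ⟧ ≡ not b
  ⟦Quant⟧-constant true  h≡false = dec-false lem λ (x , hx) → not-¬ (h≡false x) hx
  ⟦Quant⟧-constant false h≡true  = dec-true lem h≡true

  bounded-limit-Quant : ∀ b (h : ℕ → Bool) → Limit (λ n → bounded b n h) ⟦ Quant b h ⟧
  bounded-limit-Quant b h with lem {Σ[ x ∈ ℕ ] h x ≡ b}
  ... | yes (x , hx≡b) = x , λ n x≤n →
    trans (bounded-witness b n x≤n hx≡b) (sym (⟦Quant⟧-witness b hx≡b))
  ... | no ∄x = 0 , λ n _ → trans (bounded-constant b n h≡not-b) (sym (⟦Quant⟧-constant b h≡not-b))
    where
    h≡not-b : ∀ x → h x ≡ not b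
    h≡not-b x = ¬-not λ hx≡b → ∄x (x , hx≡b)

  -- bs bounds the leading quantifiers; bounds beyond the r quantifiers are ignored.
  truncatedAlt : ∀ {j} (r : ℕ) → Bool → Vec ℕ j → (Vec ℕ r → Bool) → Bool
  truncatedAlt zero    b bs       P = P []
  truncatedAlt (suc r) b []       P = ⟦ Alt (suc r) b (λ xs → P xs ≡ true) ⟧
  truncatedAlt (suc r) b (n ∷ bs) P = bounded b n (λ x → truncatedAlt r (not b) bs (λ xs → P (x ∷ xs)))

  truncatedAlt-exact : ∀ r b (P : Vec ℕ r → Bool) →
    truncatedAlt r b [] P ≡ true ⇔ Alt r b (λ xs → P xs ≡ true)
  truncatedAlt-exact zero    b P = ⇔-id _
  truncatedAlt-exact (suc r) b P = ⟦⟧-true⇔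

  truncatedAlt-limit : ∀ {j} r b (bs : Vec ℕ j) (P : Vec ℕ r → Bool) → j < r →
    Limit (λ n → truncatedAlt r b (bs ∷ʳ n) P) (truncatedAlt r b bs P)
  truncatedAlt-limit (suc r) b [] P _ = subst (Limit _)
    (⟦⟧-cong (Quant⇔Alt b r λ x → truncatedAlt-exact r (not b) (λ xs → P (x ∷ xs))))
    (bounded-limit-Quant b _)
  truncatedAlt-limit (suc r) b (n ∷ bs) P (s≤s j<r) = bounded-limit b n λ x →
    truncatedAlt-limit r (not b) bs (λ xs → P (x ∷ xs)) j<r

  truncatedAlt-cong : ∀ {r} b (bs : Vec ℕ r) {P P′ : Vec ℕ r → Bool} →
    (∀ xs → xs ∈ box bs → P xs ≡ P′ xs) → truncatedAlt r b bs P ≡ truncatedAlt r b bs P′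
  truncatedAlt-cong b []       P≗P′ = P≗P′ [] (here refl)
  truncatedAlt-cong b (n ∷ bs) P≗P′ = bounded-cong b n λ x x≤n →
    truncatedAlt-cong (not b) bs λ xs xs∈box →
      P≗P′ (x ∷ xs) (∈-cartesianProductWith⁺ _∷_ (∈-upTo⁺ {suc n} (s≤s x≤n)) xs∈box)

  module _ (m : ℕ) (β : Vec ℕ m ⤖ (ℕ × ℕ)) where

    -- The outermost limit variable (the last entry of ns) bounds the first quantifier.
    level : (k : ℕ) → Vec ℕ k → Ω₁ → Bool
    level k ns A = truncatedAlt m true (reverse ns) (Pm m β A)

    level-limit : ∀ {k} → k < m → ∀ ns A → Limit (λ n → level (suc k) (n ∷ ns) A) (level k ns A)
    level-limit k<m ns A =
      limit-congˡ (λ n → cong (λ bs → truncatedAlt m true bs (Pm m β A)) (reverse-∷ n ns))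
        (truncatedAlt-limit m true (reverse ns) (Pm m β A) k<m)

    level-iteratedLimits : ∀ k → k ≤ m → IteratedLimits k (level k) (Xi m β)
    level-iteratedLimits zero    _   A = truncatedAlt-exact m true (Pm m β A)
    level-iteratedLimits (suc k) k<m = level k , level-limit k<m , level-iteratedLimits k (<⇒≤ k<m)

    level-algorithm : Vec ℕ m → GeneralAlgorithm
    level-algorithm ns = record
      { Γ          = level m ns
      ; Λ          = λ _ → queried
      ; nonempty   = λ _ → queried-nonempty
      ; dependsOn  = λ A B B≗A → truncatedAlt-cong true (reverse ns) λ xs xs∈box →
          B≗A (Bijection.to β xs) (∈-map⁺ (Bijection.to β) xs∈box)
      ; consistent = λ _ _ _ _ → ⇔-id _
      }
      where
      queried : List Pos
      queried = map (Bijection.to β) (box (reverse ns))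

      queried-nonempty : queried ≢ []
      queried-nonempty queried≡[]
        with subst (_ ∈_) queried≡[] (∈-map⁺ (Bijection.to β) (zeros∈box (reverse ns)))
      ... | ()

propositionE3 : ExcludedMiddle 0ℓ →
    (m : ℕ) → 1 ≤ m → (β : Vec ℕ m ⤖ (ℕ × ℕ)) → Tower m (Xi m β)
propositionE3 lem m _ β = level-algorithm m β , level-iteratedLimits m β m ≤-refl
  where open Classical lem
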